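{- For any compositions $\beta,\alpha_1,\dots,\alpha_r$, the limit $$\lim_{n_1,\dots,n_r\to\infty}\mathcal{K}_{\beta*0^{n_1}*\alpha_1*\cdots*0^{n_r}*\alpha_r}(y_1,\dots,y_{\ell(\beta)},x_{1,1},\dots,x_{1,n_1},z_{1,1},\dots,z_{1,\ell(\alpha_1)},\dots,x_{r,1},\dots,x_{r,n_r},z_{r,1},\dots,z_{r,\ell(\alpha_r)})$$ exists as a formal power series (i.e. the coefficient of each monomial is eventually constant as all $n_i\to\infty$).
   Context: Compositions are finite sequences of nonnegative integers, $\ell$ denotes length, $*$ concatenation, $0^m$ a string of $m$ zeros. Isobaric divided difference: $\xi_i f=\frac{x_if-x_{i+1}s_if}{x_i-x_{i+1}}$ where $s_i$ swaps $x_i,x_{i+1}$. Key polynomials $\mathcal{K}_\alpha(x_1,\dots,x_n)$ for $\alpha\in\mathbb{Z}_{\ge0}^n$ are the unique polynomials with $\mathcal{K}_\alpha=x^\alpha$ if $\alpha_1\ge\cdots\ge\alpha_n$ and $\mathcal{K}_{s_i\alpha}=\xi_i\mathcal{K}_\alpha$ whenever $\alpha_i>\alpha_{i+1}$ ($s_i\alpha$ swaps entries $i,i+1$); the variables are substituted in the listed order. -}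

module Defs where

open import Data.Nat using (ℕ; zero; suc; _+_; _≤_; _<_)
open import Data.Nat.Properties using () renaming (_≟_ to _≟ℕ_)
open import Data.Integer using (ℤ; _-_; 0ℤ; 1ℤ)
open import Data.Vec using (Vec; []; _∷_; _++_; replicate; fromList)
open import Data.Vec.Properties using (≡-dec)
open import Data.List using (List; length)
import Data.List as L
open import Data.Maybe using (Maybe; just; nothing; maybe; _>>=_)
import Data.Maybe as M
open import Data.Product using (_×_; _,_)
open import Data.Unit using (⊤; tt)
open import Data.Bool using (if_then_else_)
open import Relation.Nullary using (does)
open import Relation.Binary.PropositionalEquality using (_≡_)

-- Polynomials / formal power series in n variables x_1..x_n over ℤ,
-- represented by their coefficient function on exponent vectors.

Exp : ℕ → Set
Exp n = Vec ℕ n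

Ser : ℕ → Set
Ser n = Exp n → ℤ

-- entry i v = v_{i+1} (0-based index), 0 if out of range
entry : ∀ {n} → ℕ → Exp n → ℕ
entry i [] = 0
entry zero (a ∷ _) = a
entry (suc i) (_ ∷ v) = entry i v

-- swap entries at 0-based positions i and i+1 (identity if out of range)
swapAt : ∀ {A : Set} {n} → ℕ → Vec A n → Vec A n
swapAt zero [] = []
swapAt zero (a ∷ []) = a ∷ []
swapAt zero (a ∷ b ∷ v) = b ∷ a ∷ v
swapAt (suc i) [] = []
swapAt (suc i) (a ∷ v) = a ∷ swapAt i v

decAt : ∀ {n} → ℕ → Exp n → Maybe (Exp n)
decAt i [] = nothing
decAt zero (zero ∷ v) = nothing
decAt zero (suc a ∷ v) = just (a ∷ v)
decAt (suc i) (a ∷ v) = M.map (a ∷_) (decAt i v)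

-- multiplication by the variable x_{i+1} (0-based i)
mulVar : ∀ {n} → ℕ → Ser n → Ser n
mulVar i f e = maybe f 0ℤ (decAt i e)

swapVars : ∀ {n} → ℕ → Ser n → Ser n
swapVars i f e = f (swapAt i e)

monomial : ∀ {n} → Exp n → Ser n
monomial α e = if does (≡-dec _≟ℕ_ e α) then 1ℤ else 0ℤ

Decreasing : ∀ {n} → Exp n → Set
Decreasing [] = ⊤
Decreasing (a ∷ []) = ⊤
Decreasing (a ∷ b ∷ v) = b ≤ a × Decreasing (b ∷ v)

-- The isobaric divided difference g = ξ_i f is characterised by
-- (x_i - x_{i+1}) g = x_i f - x_{i+1} s_i f (x_i - x_{i+1} is a non-zero-divisor).

KeyFamily : Set
KeyFamily = (n : ℕ) → Exp n → Ser n

record IsKeyFamily (K : KeyFamily) : Set where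
  field
    dominant : ∀ n (α : Exp n) → Decreasing α → ∀ e → K n α e ≡ monomial α e
    demazure : ∀ n (α : Exp n) (i : ℕ) → suc i < n → entry (suc i) α < entry i α →
      ∀ e → mulVar i (K n (swapAt i α)) e - mulVar (suc i) (K n (swapAt i α)) e
            ≡ mulVar i (K n α) e - mulVar (suc i) (swapVars i (K n α)) e

blocksLen : ∀ {r} → Vec (List ℕ) r → Vec ℕ r → ℕ
blocksLen [] [] = 0
blocksLen (a ∷ as) (n ∷ ns) = n + length a + blocksLen as ns

blocks : ∀ {r} (as : Vec (List ℕ) r) (ns : Vec ℕ r) → Vec ℕ (blocksLen as ns)
blocks [] [] = []
blocks (a ∷ as) (n ∷ ns) = (replicate n 0 ++ fromList a) ++ blocks as ns

comp : ∀ {r} (β : List ℕ) (as : Vec (List ℕ) r) (ns : Vec ℕ r) →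
       Vec ℕ (length β + blocksLen as ns)
comp β as ns = fromList β ++ blocks as ns

-- Monomials in the limiting variables y_1..y_{ℓ(β)}, x_{i,j} (j ≥ 1),
-- z_{i,1..ℓ(α_i)}: exponents of y as a vector, and per block i a finite
-- list of exponents of x_{i,1}, x_{i,2}, ... (all later ones 0) and a
-- vector of exponents of the z_{i,k}.

MonoBlocks : ∀ {r} → Vec (List ℕ) r → Set
MonoBlocks [] = ⊤
MonoBlocks (a ∷ as) = List ℕ × Vec ℕ (length a) × MonoBlocks as

padTo : (n : ℕ) → List ℕ → Maybe (Vec ℕ n)
padTo n L.[] = just (replicate n 0)
padTo zero (_ L.∷ _) = nothing
padTo (suc n) (x L.∷ xs) = M.map (x ∷_) (padTo n xs)

blockExp : ∀ {r} (as : Vec (List ℕ) r) (ns : Vec ℕ r) → MonoBlocks as →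
           Maybe (Vec ℕ (blocksLen as ns))
blockExp [] [] tt = just []
blockExp (a ∷ as) (n ∷ ns) (xe , ze , bs) =
  padTo n xe >>= λ p → blockExp as ns bs >>= λ rest → just ((p ++ ze) ++ rest)

-- coefficient of the monomial (ye , bs) in
-- K_{β*0^{n_1}*α_1*...*0^{n_r}*α_r}(y, x_1, z_1, ..., x_r, z_r);
-- it is 0 when the monomial uses a variable x_{i,j} with j > n_i.
keyCoeff : KeyFamily → ∀ {r} (β : List ℕ) (as : Vec (List ℕ) r) (ns : Vec ℕ r) →
           Vec ℕ (length β) → MonoBlocks as → ℤ
keyCoeff K β as ns ye bs =
  maybe (λ e → K _ (comp β as ns) (ye ++ e)) 0ℤ (blockExp as ns bs)

{-# OPTIONS --safe #-}
-- Key polynomials are stable under inserting a zero part: if γ′ is γ with a 0 inserted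
-- at position m, then setting the corresponding variable to 0 in K_γ′ gives K_γ.  This
-- goes by induction on Σⱼ j γ′ⱼ.  For dominant γ′ both sides are monomials; otherwise
-- γ′ has an ascent i and K_γ′ = ξ_i K_{s_i γ′}.  If the ascent starts at the inserted
-- zero, then at x_m = 0 the operator ξ_m acts as s_m and moves the zero one step to the
-- right; otherwise ξ_i commutes with the specialisation, and multiplication by
-- x_i - x_{i+1} is injective.  Once n_i exceeds the number of variables x_{i,j} a
-- monomial involves, increasing n_i only inserts a zero part whose variable does not
-- occur, so the coefficient no longer changes.
module Submission where

open import Defs
open import Algebra using (AbelianGroup)
open import Data.Nat using (ℕ; zero; suc; _+_; _≤_; _<_; _⊔_; z≤n; s≤s)
open import Data.Nat.Properties
  using (≤-trans; ≤-pred; <-≤-trans; <-cmp; n<1+n; n≮0; m≤m+n; m≤m⊔n; m≤n⊔m; m≤n⇒m<n∨m≡n;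
         +-commutativeSemigroup; +-monoˡ-<; +-monoʳ-<; _≟_; _≤?_; ≰⇒>)
open import Data.Integer using (ℤ; _-_; 0ℤ)
open import Data.Integer.Properties using (+-0-abelianGroup; neg-injective; +-identityˡ; +-identityʳ)
open import Algebra.Properties.CommutativeSemigroup +-commutativeSemigroup using (x∙yz≈y∙xz)
open import Algebra.Properties.Group (AbelianGroup.group +-0-abelianGroup) using (∙-cancelʳ)
open import Data.List using (List; length)
import Data.List as List
open import Data.Vec using (Vec; []; _∷_; _++_; _∷ʳ_; replicate; fromList; sum)
open import Data.Vec.Properties using (≡-dec; ∷-injective)
open import Data.Vec.Relation.Unary.All using (All; []; _∷_)
import Data.Vec.Relation.Unary.All as All
open import Data.Maybe using (Maybe; just; nothing; maybe; maybe′)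
import Data.Maybe as Maybe
open import Data.Maybe.Properties using (map-∘; maybe-map)
open import Data.Product using (Σ; _×_; _,_; proj₁; proj₂; ∃-syntax)
open import Data.Sum using (_⊎_; inj₁; inj₂)
open import Data.Unit using (tt)
open import Data.Empty using (⊥-elim)
open import Relation.Nullary using (yes; no)
open import Relation.Binary using (tri<; tri≈; tri>)
open import Relation.Binary.PropositionalEquality
  using (_≡_; refl; sym; trans; cong; cong₂; subst; subst₂; module ≡-Reasoning)
open ≡-Reasoning

Ascent : ∀ {n} → ℕ → Vec ℕ n → Set
Ascent i v = entry i v < entry (suc i) v

insertZero : ∀ {n} → ℕ → Vec ℕ n → Vec ℕ (suc n)
insertZero zero    v       = 0 ∷ v
insertZero (suc m) []      = 0 ∷ []
insertZero (suc m) (a ∷ v) = a ∷ insertZero m v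

-- weight v = Σⱼ j vⱼ, which swapping an ascent strictly lowers.
weight : ∀ {n} → Vec ℕ n → ℕ
weight []      = 0
weight (a ∷ v) = sum v + weight v

swapAt-involutive : ∀ {A : Set} {n} i (v : Vec A n) → swapAt i (swapAt i v) ≡ v
swapAt-involutive zero    []          = refl
swapAt-involutive zero    (a ∷ [])    = refl
swapAt-involutive zero    (a ∷ b ∷ v) = refl
swapAt-involutive (suc i) []          = refl
swapAt-involutive (suc i) (a ∷ v)     = cong (a ∷_) (swapAt-involutive i v)

ascent⇒suc<length : ∀ {n} i (v : Vec ℕ n) → Ascent i v → suc i < n
ascent⇒suc<length zero    (a ∷ b ∷ v) _  = s≤s (s≤s z≤n)
ascent⇒suc<length (suc i) (a ∷ v)     lt = s≤s (ascent⇒suc<length i v lt)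

swapAt-ascent : ∀ {n} i (v : Vec ℕ n) → Ascent i v → entry (suc i) (swapAt i v) < entry i (swapAt i v)
swapAt-ascent zero    (a ∷ b ∷ v) lt = lt
swapAt-ascent (suc i) (a ∷ v)     lt = swapAt-ascent i v lt

sum-swapAt : ∀ {n} i (v : Vec ℕ n) → sum (swapAt i v) ≡ sum v
sum-swapAt zero    []          = refl
sum-swapAt zero    (a ∷ [])    = refl
sum-swapAt zero    (a ∷ b ∷ v) = x∙yz≈y∙xz b a (sum v)
sum-swapAt (suc i) []          = refl
sum-swapAt (suc i) (a ∷ v)     = cong (a +_) (sum-swapAt i v)

weight-swapAt-ascent : ∀ {n} i (v : Vec ℕ n) → Ascent i v → weight (swapAt i v) < weight v
weight-swapAt-ascent zero    (a ∷ b ∷ v) lt = +-monoˡ-< _ (+-monoˡ-< (sum v) lt)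
weight-swapAt-ascent (suc i) (a ∷ v)     lt rewrite sum-swapAt i v =
  +-monoʳ-< (sum v) (weight-swapAt-ascent i v lt)

decreasing-or-ascent : ∀ {n} (v : Vec ℕ n) → Decreasing v ⊎ ∃[ i ] Ascent i v
decreasing-or-ascent []      = inj₁ tt
decreasing-or-ascent (a ∷ v) = extend v (decreasing-or-ascent v)
  where
  extend : ∀ {n} (v : Vec ℕ n) → Decreasing v ⊎ ∃[ i ] Ascent i v →
           Decreasing (a ∷ v) ⊎ ∃[ i ] Ascent i (a ∷ v)
  extend []      _ = inj₁ tt
  extend (b ∷ v) r with b ≤? a | r
  ... | no b≰a  | _              = inj₂ (0 , ≰⇒> b≰a)
  ... | yes b≤a | inj₁ dec       = inj₁ (b≤a , dec)
  ... | yes b≤a | inj₂ (i , asc) = inj₂ (suc i , asc)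

Decreasing-insertZero⁻ : ∀ {n} m (v : Vec ℕ n) → Decreasing (insertZero m v) → Decreasing v
Decreasing-insertZero⁻ zero          []          _         = tt
Decreasing-insertZero⁻ zero          (a ∷ v)     (_ , dec) = dec
Decreasing-insertZero⁻ (suc m)       []          _   = tt
Decreasing-insertZero⁻ (suc m)       (a ∷ [])    _   = tt
Decreasing-insertZero⁻ (suc zero)    (a ∷ b ∷ v) (0≤a , b≤0 , dec) = ≤-trans b≤0 0≤a , dec
Decreasing-insertZero⁻ (suc (suc m)) (a ∷ b ∷ v) (b≤a , dec) =
  b≤a , Decreasing-insertZero⁻ (suc m) (b ∷ v) dec

insertZero-injective : ∀ {n} m {v w : Vec ℕ n} → insertZero m v ≡ insertZero m w → v ≡ w
insertZero-injective zero    refl = refl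
insertZero-injective (suc m) {[]}    {[]}    _  = refl
insertZero-injective (suc m) {a ∷ v} {b ∷ w} eq with ∷-injective eq
... | refl , eq′ = cong (a ∷_) (insertZero-injective m eq′)

monomial-insertZero : ∀ {n} m (γ e : Vec ℕ n) →
  monomial (insertZero m γ) (insertZero m e) ≡ monomial γ e
monomial-insertZero m γ e with ≡-dec _≟_ e γ | ≡-dec _≟_ (insertZero m e) (insertZero m γ)
... | yes _    | yes _   = refl
... | no  _    | no  _   = refl
... | yes refl | no  e≢γ = ⊥-elim (e≢γ refl)
... | no  e≢γ  | yes eq  = ⊥-elim (e≢γ (insertZero-injective m eq))

entry-insertZero-self : ∀ {n} m (v : Vec ℕ n) → m ≤ n → entry m (insertZero m v) ≡ 0
entry-insertZero-self zero    v       _         = refl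
entry-insertZero-self (suc m) (a ∷ v) (s≤s m≤n) = entry-insertZero-self m v m≤n

swapAt-insertZero-self : ∀ {n} m (v : Vec ℕ n) → m < n → swapAt m (insertZero m v) ≡ insertZero (suc m) v
swapAt-insertZero-self zero    (a ∷ v) _         = refl
swapAt-insertZero-self (suc m) (a ∷ v) (s≤s m<n) = cong (a ∷_) (swapAt-insertZero-self m v m<n)

record Tracks (n m i i′ : ℕ) : Set where
  field
    entry-i   : (w : Vec ℕ n) → entry i (insertZero m w) ≡ entry i′ w
    entry-suc : (w : Vec ℕ n) → entry (suc i) (insertZero m w) ≡ entry (suc i′) w
    swapAt-i  : (w : Vec ℕ n) → swapAt i (insertZero m w) ≡ insertZero m (swapAt i′ w)
    decAt-i   : (w : Vec ℕ n) →
                decAt i (insertZero m w) ≡ Maybe.map (insertZero m) (decAt i′ w)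
    decAt-suc : (w : Vec ℕ n) →
                decAt (suc i) (insertZero m w) ≡ Maybe.map (insertZero m) (decAt (suc i′) w)

map-∷-insertZero : ∀ {n} a m (x : Maybe (Vec ℕ n)) →
  Maybe.map (a ∷_) (Maybe.map (insertZero m) x) ≡ Maybe.map (insertZero (suc m)) (Maybe.map (a ∷_) x)
map-∷-insertZero a m x = trans (sym (map-∘ {g = a ∷_} {f = insertZero m} x)) (map-∘ x)

tracks-suc : ∀ {n m i i′} → Tracks n m i i′ → Tracks (suc n) (suc m) (suc i) (suc i′)
tracks-suc {m = m} {i′ = i′} tr = record
  { entry-i   = λ { (a ∷ w) → entry-i w }
  ; entry-suc = λ { (a ∷ w) → entry-suc w }
  ; swapAt-i  = λ { (a ∷ w) → cong (a ∷_) (swapAt-i w) }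
  ; decAt-i   = λ { (a ∷ w) → trans (cong (Maybe.map (a ∷_)) (decAt-i w))
                                     (map-∷-insertZero a m (decAt i′ w)) }
  ; decAt-suc = λ { (a ∷ w) → trans (cong (Maybe.map (a ∷_)) (decAt-suc w))
                                     (map-∷-insertZero a m (decAt (suc i′) w)) }
  }
  where open Tracks tr

tracks-below : ∀ {n} i m → suc i < m → m ≤ n → Tracks n m i i
tracks-below zero    (suc (suc m)) _ (s≤s (s≤s _)) = record
  { entry-i   = λ { (a ∷ b ∷ w) → refl }
  ; entry-suc = λ { (a ∷ b ∷ w) → refl }
  ; swapAt-i  = λ { (a ∷ b ∷ w) → refl }
  ; decAt-i   = λ { (zero ∷ b ∷ w) → refl ; (suc a ∷ b ∷ w) → refl }
  ; decAt-suc = λ { (a ∷ zero ∷ w) → refl ; (a ∷ suc b ∷ w) → refl }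
  }
tracks-below zero    (suc zero)    (s≤s ()) _
tracks-below (suc i) (suc m) (s≤s i<m) (s≤s m≤n) = tracks-suc (tracks-below i m i<m m≤n)

tracks-above : ∀ {n} i m → m ≤ i → m ≤ n → Tracks n m (suc i) i
tracks-above i zero _ _ = record
  { entry-i   = λ _ → refl
  ; entry-suc = λ _ → refl
  ; swapAt-i  = λ _ → refl
  ; decAt-i   = λ _ → refl
  ; decAt-suc = λ _ → refl
  }
tracks-above (suc i) (suc m) (s≤s m≤i) (s≤s m≤n) = tracks-suc (tracks-above i m m≤i m≤n)

ascent-insertZero : ∀ {n} i m (γ : Vec ℕ n) → m ≤ n → Ascent i (insertZero m γ) →
                    i ≡ m ⊎ ∃[ i′ ] Tracks n m i i′ × Ascent i′ γ
ascent-insertZero i m γ m≤n asc with <-cmp (suc i) m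
... | tri< si<m _ _ = inj₂ (i , tr , subst₂ _<_ (Tracks.entry-i tr γ) (Tracks.entry-suc tr γ) asc)
  where tr = tracks-below i m si<m m≤n
... | tri≈ _ refl _ =
  ⊥-elim (n≮0 (subst (entry i (insertZero m γ) <_) (entry-insertZero-self m γ m≤n) asc))
... | tri> _ _ (s≤s m≤i) with m≤n⇒m<n∨m≡n m≤i
...   | inj₂ m≡i = inj₁ (sym m≡i)
...   | inj₁ (s≤s {n = i′} m≤i′) =
  inj₂ (i′ , tr , subst₂ _<_ (Tracks.entry-i tr γ) (Tracks.entry-suc tr γ) asc)
  where tr = tracks-above i′ m m≤i′ m≤n

mulDiff : ∀ {n} → ℕ → Ser n → Ser n
mulDiff i f e = mulVar i f e - mulVar (suc i) f e

-- F = ξ_i G, with the denominator cleared as in IsKeyFamily.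
_≡ξ[_]_ : ∀ {n} → Ser n → ℕ → Ser n → Set
F ≡ξ[ i ] G = ∀ e → mulDiff i F e ≡ mulVar i G e - mulVar (suc i) (swapVars i G) e

mulVar-cong : ∀ {n} j {f g : Ser n} → (∀ e → f e ≡ g e) → ∀ e → mulVar j f e ≡ mulVar j g e
mulVar-cong j f≗g e with decAt j e
... | nothing = refl
... | just e′ = f≗g e′

mulVar-suc-∷ : ∀ {n} j (f : Ser (suc n)) c (w : Exp n) →
  mulVar (suc j) f (c ∷ w) ≡ mulVar j (λ v → f (c ∷ v)) w
mulVar-suc-∷ j f c w = maybe-map f 0ℤ (c ∷_) (decAt j w)

mulVar-insertZero : ∀ {n} m j j′ (f : Ser (suc n)) (w : Exp n) →
  decAt j (insertZero m w) ≡ Maybe.map (insertZero m) (decAt j′ w) →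
  mulVar j f (insertZero m w) ≡ mulVar j′ (λ v → f (insertZero m v)) w
mulVar-insertZero m j j′ f w eq = trans (cong (maybe f 0ℤ) eq) (maybe-map f 0ℤ (insertZero m) (decAt j′ w))

mulDiff-suc-∷ : ∀ {n} i (f : Ser (suc n)) c (w : Exp n) →
  mulDiff (suc i) f (c ∷ w) ≡ mulDiff i (λ v → f (c ∷ v)) w
mulDiff-suc-∷ i f c w = cong₂ _-_ (mulVar-suc-∷ i f c w) (mulVar-suc-∷ (suc i) f c w)

≡ξ-∷ : ∀ {n} i c {F G : Ser (suc n)} →
  F ≡ξ[ suc i ] G → (λ v → F (c ∷ v)) ≡ξ[ i ] (λ v → G (c ∷ v))
≡ξ-∷ i c {F} {G} ξ w = begin
  mulDiff i (λ v → F (c ∷ v)) w                       ≡⟨ mulDiff-suc-∷ i F c w ⟨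
  mulDiff (suc i) F (c ∷ w)                           ≡⟨ ξ (c ∷ w) ⟩
  mulVar (suc i) G (c ∷ w) - mulVar (suc (suc i)) (swapVars (suc i) G) (c ∷ w)
    ≡⟨ cong₂ _-_ (mulVar-suc-∷ i G c w) (mulVar-suc-∷ (suc i) (swapVars (suc i) G) c w) ⟩
  mulVar i (λ v → G (c ∷ v)) w - mulVar (suc i) (swapVars i (λ v → G (c ∷ v))) w ∎

-- x_i - x_{i+1} is not a zero divisor: compare coefficients by induction on the
-- exponent of x_{i+1}.
mulDiff-injective : ∀ {n} i → suc i < n → {f g : Ser n} →
  (∀ e → mulDiff i f e ≡ mulDiff i g e) → ∀ e → f e ≡ g e
mulDiff-injective zero (s≤s (s≤s z≤n)) {f} {g} eq (a ∷ b ∷ w) = go b a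
  where
  go : ∀ b a → f (a ∷ b ∷ w) ≡ g (a ∷ b ∷ w)
  go zero    a = trans (sym (+-identityʳ _)) (trans (eq (suc a ∷ zero ∷ w)) (+-identityʳ _))
  go (suc b) a = ∙-cancelʳ _ _ _ (begin
    f (a ∷ suc b ∷ w) - f (suc a ∷ b ∷ w) ≡⟨ eq (suc a ∷ suc b ∷ w) ⟩
    g (a ∷ suc b ∷ w) - g (suc a ∷ b ∷ w) ≡⟨ cong (g (a ∷ suc b ∷ w) -_) (go b (suc a)) ⟨
    g (a ∷ suc b ∷ w) - f (suc a ∷ b ∷ w) ∎)
mulDiff-injective (suc i) (s≤s lt) {f} {g} eq (c ∷ w) =
  mulDiff-injective i lt
    (λ v → trans (sym (mulDiff-suc-∷ i f c v)) (trans (eq (c ∷ v)) (mulDiff-suc-∷ i g c v))) w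

≡ξ-unique : ∀ {n} i → suc i < n → {F F′ G G′ : Ser n} →
  F ≡ξ[ i ] G → F′ ≡ξ[ i ] G′ → (∀ e → G e ≡ G′ e) → ∀ e → F e ≡ F′ e
≡ξ-unique i lt {G = G} {G′} ξ ξ′ G≗G′ = mulDiff-injective i lt λ e →
  trans (ξ e) (trans (cong₂ _-_ (mulVar-cong i G≗G′ e)
                                (mulVar-cong (suc i) (λ v → G≗G′ (swapAt i v)) e))
                     (sym (ξ′ e)))

-- At an exponent e with e_i = 0 the term x_i G vanishes, and comparing
-- coefficients of x_{i+1} x^e gives F e = (s_i G) e.
≡ξ-entry-zero : ∀ {n} i → suc i < n → {F G : Ser n} → F ≡ξ[ i ] G →
  ∀ e → entry i e ≡ 0 → F e ≡ G (swapAt i e)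
≡ξ-entry-zero zero (s≤s (s≤s z≤n)) ξ (zero ∷ t ∷ w) refl =
  neg-injective (trans (sym (+-identityˡ _)) (trans (ξ (0 ∷ suc t ∷ w)) (+-identityˡ _)))
≡ξ-entry-zero (suc i) (s≤s lt) ξ (c ∷ w) = ≡ξ-entry-zero i lt (≡ξ-∷ i c ξ) w

≡ξ-insertZero : ∀ {n m i i′} → Tracks n m i i′ → {F G : Ser (suc n)} → F ≡ξ[ i ] G →
  (λ w → F (insertZero m w)) ≡ξ[ i′ ] (λ w → G (insertZero m w))
≡ξ-insertZero {m = m} {i} {i′} tr {F} {G} ξ w = begin
  mulDiff i′ (λ v → F (insertZero m v)) w
    ≡⟨ cong₂ _-_ (mulVar-insertZero m i i′ F w (decAt-i w))
                 (mulVar-insertZero m (suc i) (suc i′) F w (decAt-suc w)) ⟨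
  mulDiff i F (insertZero m w)
    ≡⟨ ξ (insertZero m w) ⟩
  mulVar i G (insertZero m w) - mulVar (suc i) (swapVars i G) (insertZero m w)
    ≡⟨ cong₂ _-_ (mulVar-insertZero m i i′ G w (decAt-i w))
                 (trans (mulVar-insertZero m (suc i) (suc i′) (swapVars i G) w (decAt-suc w))
                        (mulVar-cong (suc i′) (λ v → cong G (swapAt-i v)) w)) ⟩
  mulVar i′ (λ v → G (insertZero m v)) w
    - mulVar (suc i′) (swapVars i′ (λ v → G (insertZero m v))) w ∎
  where open Tracks tr

InsertZeroInvariant : KeyFamily → ∀ {n} → Vec ℕ n → ℕ → Set
InsertZeroInvariant K {n} γ m = ∀ e → K (suc n) (insertZero m γ) (insertZero m e) ≡ K n γ e

module KeyFamilyProperties (K : KeyFamily) (isKey : IsKeyFamily K) where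
  open IsKeyFamily isKey

  key-≡ξ : ∀ {n} i (γ : Vec ℕ n) → Ascent i γ → K n γ ≡ξ[ i ] K n (swapAt i γ)
  key-≡ξ {n} i γ asc =
    subst (λ α → K n α ≡ξ[ i ] K n (swapAt i γ)) (swapAt-involutive i γ)
      (demazure n (swapAt i γ) i (ascent⇒suc<length i γ asc) (swapAt-ascent i γ asc))

  InvariantBelow : ℕ → ℕ → Set
  InvariantBelow n w =
    ∀ (γ : Vec ℕ n) m → m ≤ n → weight (insertZero m γ) < w → InsertZeroInvariant K γ m

  invariantBelow-mono : ∀ {n v w} → v ≤ w → InvariantBelow n w → InvariantBelow n v
  invariantBelow-mono v≤w IH γ m m≤n lt = IH γ m m≤n (<-≤-trans lt v≤w)

  insertZeroInvariant-decreasing : ∀ {n} (γ : Vec ℕ n) m →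
    Decreasing (insertZero m γ) → InsertZeroInvariant K γ m
  insertZeroInvariant-decreasing {n} γ m dec e = begin
    K (suc n) (insertZero m γ) (insertZero m e) ≡⟨ dominant _ _ dec _ ⟩
    monomial (insertZero m γ) (insertZero m e)  ≡⟨ monomial-insertZero m γ e ⟩
    monomial γ e                                 ≡⟨ dominant _ _ (Decreasing-insertZero⁻ m γ dec) e ⟨
    K n γ e                                      ∎

  -- At x_m = 0, ξ_m acts as s_m, which moves the inserted zero one place to the right.
  insertZeroInvariant-ascent-at : ∀ {n} (γ : Vec ℕ n) m → m ≤ n →
    InvariantBelow n (weight (insertZero m γ)) → Ascent m (insertZero m γ) → InsertZeroInvariant K γ m
  insertZeroInvariant-ascent-at {n} γ m m≤n IH asc e = begin
    K (suc n) (insertZero m γ) (insertZero m e)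
      ≡⟨ ≡ξ-entry-zero m (s≤s m<n) (key-≡ξ m (insertZero m γ) asc) (insertZero m e)
                       (entry-insertZero-self m e m≤n) ⟩
    K (suc n) (swapAt m (insertZero m γ)) (swapAt m (insertZero m e))
      ≡⟨ cong₂ (K (suc n)) (swapAt-insertZero-self m γ m<n) (swapAt-insertZero-self m e m<n) ⟩
    K (suc n) (insertZero (suc m) γ) (insertZero (suc m) e)
      ≡⟨ IH γ (suc m) m<n weight< e ⟩
    K n γ e ∎
    where
    m<n : m < n
    m<n = ≤-pred (ascent⇒suc<length m (insertZero m γ) asc)
    weight< : weight (insertZero (suc m) γ) < weight (insertZero m γ)
    weight< = subst (λ v → weight v < weight (insertZero m γ)) (swapAt-insertZero-self m γ m<n)
                    (weight-swapAt-ascent m (insertZero m γ) asc)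

  -- Both sides are ξ_i′ of the same series, by induction for the left one.
  insertZeroInvariant-tracked : ∀ {n} (γ : Vec ℕ n) m {i i′} → m ≤ n →
    InvariantBelow n (weight (insertZero m γ)) → Tracks n m i i′ →
    Ascent i (insertZero m γ) → Ascent i′ γ → InsertZeroInvariant K γ m
  insertZeroInvariant-tracked {n} γ m {i} {i′} m≤n IH tr asc asc′ =
    ≡ξ-unique i′ (ascent⇒suc<length i′ γ asc′)
      (≡ξ-insertZero tr (key-≡ξ i (insertZero m γ) asc)) (key-≡ξ i′ γ asc′)
      (λ w → trans (cong (λ α → K (suc n) α (insertZero m w)) (swapAt-i γ))
                   (IH (swapAt i′ γ) m m≤n weight< w))
    where
    open Tracks tr
    weight< : weight (insertZero m (swapAt i′ γ)) < weight (insertZero m γ)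
    weight< = subst (λ v → weight v < weight (insertZero m γ)) (swapAt-i γ)
                    (weight-swapAt-ascent i (insertZero m γ) asc)

  invariantBelow : ∀ {n} w → InvariantBelow n w
  invariantBelow zero    _ _ _   ()
  invariantBelow (suc w) γ m m≤n w<1+w with decreasing-or-ascent (insertZero m γ)
  ... | inj₁ dec = insertZeroInvariant-decreasing γ m dec
  ... | inj₂ (i , asc) with ascent-insertZero i m γ m≤n asc
  ...   | inj₁ refl =
    insertZeroInvariant-ascent-at γ m m≤n (invariantBelow-mono (≤-pred w<1+w) (invariantBelow w)) asc
  ...   | inj₂ (i′ , tr , asc′) =
    insertZeroInvariant-tracked γ m m≤n (invariantBelow-mono (≤-pred w<1+w) (invariantBelow w)) tr asc asc′

  key-insertZero : ∀ {n} (γ : Vec ℕ n) m → m ≤ n → InsertZeroInvariant K γ m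
  key-insertZero γ m m≤n = invariantBelow _ γ m m≤n (n<1+n _)

constant-from : ∀ {A : Set} (g : ℕ → A) a →
  (∀ k → a ≤ k → g (suc k) ≡ g k) → ∀ n → a ≤ n → g n ≡ g a
constant-from g a step n a≤n with m≤n⇒m<n∨m≡n a≤n
... | inj₂ refl = refl
... | inj₁ (s≤s {n = k} a≤k) = trans (step k a≤k) (constant-from g a step k a≤k)

maybe-cong : ∀ {A B : Set} {f g : A → B} d →
  (∀ x → f x ≡ g x) → ∀ mx → maybe′ f d mx ≡ maybe′ g d mx
maybe-cong d f≗g nothing  = refl
maybe-cong d f≗g (just x) = f≗g x

replicate-∷ʳ : ∀ {A : Set} n (a : A) → replicate n a ∷ʳ a ≡ replicate (suc n) a
replicate-∷ʳ zero    a = refl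
replicate-∷ʳ (suc n) a = cong (a ∷_) (replicate-∷ʳ n a)

padTo-suc : ∀ n xs → length xs ≤ n → padTo (suc n) xs ≡ Maybe.map (_∷ʳ 0) (padTo n xs)
padTo-suc n       List.[]        _         = cong just (sym (replicate-∷ʳ n 0))
padTo-suc (suc n) (x List.∷ xs) (s≤s len≤n) = begin
  Maybe.map (x ∷_) (padTo (suc n) xs)               ≡⟨ cong (Maybe.map (x ∷_)) (padTo-suc n xs len≤n) ⟩
  Maybe.map (x ∷_) (Maybe.map (_∷ʳ 0) (padTo n xs)) ≡⟨ map-∘ (padTo n xs) ⟨
  Maybe.map (λ p → x ∷ (p ∷ʳ 0)) (padTo n xs)       ≡⟨ map-∘ (padTo n xs) ⟩
  Maybe.map (_∷ʳ 0) (Maybe.map (x ∷_) (padTo n xs)) ∎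

-- A composition with an exponent vector of the same length; packing the length
-- makes concatenation associative up to ≡.
Word : Set
Word = Σ ℕ λ n → Exp n × Exp n

infixr 5 _++ᵂ_
_++ᵂ_ : Word → Word → Word
(n , γ , e) ++ᵂ (n′ , γ′ , e′) = n + n′ , γ ++ γ′ , e ++ e′

consᵂ : ℕ → ℕ → Word → Word
consᵂ a b (n , γ , e) = suc n , a ∷ γ , b ∷ e

zeroᵂ : Word
zeroᵂ = 1 , 0 ∷ [] , 0 ∷ []

zerosᵂ : ∀ n → Exp n → Word
zerosᵂ n p = n , replicate n 0 , p

blockᵂ : (a : List ℕ) → Exp (length a) → Word
blockᵂ a ze = length a , fromList a , ze

insertZeroᵂ : ℕ → Word → Word
insertZeroᵂ m (n , γ , e) = suc n , insertZero m γ , insertZero m e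

++ᵂ-assoc : ∀ X Y Z → X ++ᵂ (Y ++ᵂ Z) ≡ (X ++ᵂ Y) ++ᵂ Z
++ᵂ-assoc (zero  , []    , [])    Y Z = refl
++ᵂ-assoc (suc n , a ∷ γ , b ∷ e) Y Z = cong (consᵂ a b) (++ᵂ-assoc (n , γ , e) Y Z)

++ᵂ-zeroᵂ : ∀ X Z → X ++ᵂ zeroᵂ ++ᵂ Z ≡ insertZeroᵂ (proj₁ X) (X ++ᵂ Z)
++ᵂ-zeroᵂ (zero  , []    , [])    Z = refl
++ᵂ-zeroᵂ (suc n , a ∷ γ , b ∷ e) Z = cong (consᵂ a b) (++ᵂ-zeroᵂ (n , γ , e) Z)

zerosᵂ-∷ʳ : ∀ n (p : Exp n) → zerosᵂ (suc n) (p ∷ʳ 0) ≡ zerosᵂ n p ++ᵂ zeroᵂ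
zerosᵂ-∷ʳ zero    []      = refl
zerosᵂ-∷ʳ (suc n) (x ∷ p) = cong (consᵂ 0 x) (zerosᵂ-∷ʳ n p)

module Stability (K : KeyFamily)
  (K-insertZero : ∀ {n} (γ : Vec ℕ n) m → m ≤ n → InsertZeroInvariant K γ m) where

  coeff : Word → ℤ
  coeff (n , γ , e) = K n γ e

  coeff-zeroᵂ : ∀ X Z → coeff (X ++ᵂ zeroᵂ ++ᵂ Z) ≡ coeff (X ++ᵂ Z)
  coeff-zeroᵂ X@(n , _ , _) Z = trans (cong coeff (++ᵂ-zeroᵂ X Z)) (K-insertZero _ n (m≤m+n _ _) _)

  coeff-zerosᵂ-∷ʳ : ∀ X n (p : Exp n) Z →
    coeff ((X ++ᵂ zerosᵂ (suc n) (p ∷ʳ 0)) ++ᵂ Z) ≡ coeff ((X ++ᵂ zerosᵂ n p) ++ᵂ Z)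
  coeff-zerosᵂ-∷ʳ X n p Z = begin
    coeff ((X ++ᵂ zerosᵂ (suc n) (p ∷ʳ 0)) ++ᵂ Z)
      ≡⟨ cong (λ W → coeff ((X ++ᵂ W) ++ᵂ Z)) (zerosᵂ-∷ʳ n p) ⟩
    coeff ((X ++ᵂ zerosᵂ n p ++ᵂ zeroᵂ) ++ᵂ Z)
      ≡⟨ cong (λ W → coeff (W ++ᵂ Z)) (++ᵂ-assoc X (zerosᵂ n p) zeroᵂ) ⟩
    coeff (((X ++ᵂ zerosᵂ n p) ++ᵂ zeroᵂ) ++ᵂ Z)
      ≡⟨ cong coeff (++ᵂ-assoc (X ++ᵂ zerosᵂ n p) zeroᵂ Z) ⟨
    coeff ((X ++ᵂ zerosᵂ n p) ++ᵂ zeroᵂ ++ᵂ Z)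
      ≡⟨ coeff-zeroᵂ (X ++ᵂ zerosᵂ n p) Z ⟩
    coeff ((X ++ᵂ zerosᵂ n p) ++ᵂ Z) ∎

  blocksᵂ : ∀ {r} (as : Vec (List ℕ) r) (ns : Vec ℕ r) → Exp (blocksLen as ns) → Word
  blocksᵂ as ns E = blocksLen as ns , blocks as ns , E

  -- keyCoeff K β is blocksCoeff applied to the word of β and ye; the prefix is
  -- generalised for the induction over the blocks.
  blocksCoeff : Word → ∀ {r} (as : Vec (List ℕ) r) → Vec ℕ r → MonoBlocks as → ℤ
  blocksCoeff A as ns bs = maybe′ (λ E → coeff (A ++ᵂ blocksᵂ as ns E)) 0ℤ (blockExp as ns bs)

  blocksCoeff-cong : ∀ {X Y} → (∀ Z → coeff (X ++ᵂ Z) ≡ coeff (Y ++ᵂ Z)) →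
    ∀ {r} (as : Vec (List ℕ) r) ns bs → blocksCoeff X as ns bs ≡ blocksCoeff Y as ns bs
  blocksCoeff-cong X≈Y as ns bs = maybe-cong 0ℤ (λ E → X≈Y _) (blockExp as ns bs)

  blocksCoeff-∷ : ∀ A {r} a (as : Vec (List ℕ) r) n ns xe ze bs →
    blocksCoeff A (a ∷ as) (n ∷ ns) (xe , ze , bs)
      ≡ maybe′ (λ p → blocksCoeff ((A ++ᵂ zerosᵂ n p) ++ᵂ blockᵂ a ze) as ns bs) 0ℤ (padTo n xe)
  blocksCoeff-∷ A a as n ns xe ze bs with padTo n xe
  ... | nothing = refl
  ... | just p with blockExp as ns bs
  ...   | nothing = refl
  ...   | just E = cong coeff (trans
    (++ᵂ-assoc A (zerosᵂ n p ++ᵂ blockᵂ a ze) (blocksᵂ as ns E))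
    (cong (_++ᵂ blocksᵂ as ns E) (++ᵂ-assoc A (zerosᵂ n p) (blockᵂ a ze))))

  blocksCoeff-suc : ∀ A {r} a (as : Vec (List ℕ) r) n ns xe ze bs → length xe ≤ n →
    blocksCoeff A (a ∷ as) (suc n ∷ ns) (xe , ze , bs) ≡ blocksCoeff A (a ∷ as) (n ∷ ns) (xe , ze , bs)
  blocksCoeff-suc A a as n ns xe ze bs len≤n = begin
    blocksCoeff A (a ∷ as) (suc n ∷ ns) (xe , ze , bs)
      ≡⟨ blocksCoeff-∷ A a as (suc n) ns xe ze bs ⟩
    maybe′ (λ p → blocksCoeff (prefix (suc n) p) as ns bs) 0ℤ (padTo (suc n) xe)
      ≡⟨ cong (maybe′ (λ p → blocksCoeff (prefix (suc n) p) as ns bs) 0ℤ) (padTo-suc n xe len≤n) ⟩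
    maybe′ (λ p → blocksCoeff (prefix (suc n) p) as ns bs) 0ℤ (Maybe.map (_∷ʳ 0) (padTo n xe))
      ≡⟨ maybe-map {C = λ _ → ℤ} _ 0ℤ (_∷ʳ 0) (padTo n xe) ⟩
    maybe′ (λ p → blocksCoeff (prefix (suc n) (p ∷ʳ 0)) as ns bs) 0ℤ (padTo n xe)
      ≡⟨ maybe-cong 0ℤ (λ p → blocksCoeff-cong (drop-zero p) as ns bs) (padTo n xe) ⟩
    maybe′ (λ p → blocksCoeff (prefix n p) as ns bs) 0ℤ (padTo n xe)
      ≡⟨ blocksCoeff-∷ A a as n ns xe ze bs ⟨
    blocksCoeff A (a ∷ as) (n ∷ ns) (xe , ze , bs) ∎
    where
    prefix : ∀ k → Exp k → Word
    prefix k p = (A ++ᵂ zerosᵂ k p) ++ᵂ blockᵂ a ze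
    drop-zero : ∀ p Z → coeff (prefix (suc n) (p ∷ʳ 0) ++ᵂ Z) ≡ coeff (prefix n p ++ᵂ Z)
    drop-zero p Z = begin
      coeff (((A ++ᵂ zerosᵂ (suc n) (p ∷ʳ 0)) ++ᵂ blockᵂ a ze) ++ᵂ Z)
        ≡⟨ cong coeff (++ᵂ-assoc _ (blockᵂ a ze) Z) ⟨
      coeff ((A ++ᵂ zerosᵂ (suc n) (p ∷ʳ 0)) ++ᵂ blockᵂ a ze ++ᵂ Z)
        ≡⟨ coeff-zerosᵂ-∷ʳ A n p (blockᵂ a ze ++ᵂ Z) ⟩
      coeff ((A ++ᵂ zerosᵂ n p) ++ᵂ blockᵂ a ze ++ᵂ Z)
        ≡⟨ cong coeff (++ᵂ-assoc _ (blockᵂ a ze) Z) ⟩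
      coeff (((A ++ᵂ zerosᵂ n p) ++ᵂ blockᵂ a ze) ++ᵂ Z) ∎

  blocksCoeff-eventually-constant : ∀ {r} (as : Vec (List ℕ) r) (bs : MonoBlocks as) →
    ∃[ N ] ∀ A → ∃[ c ] ∀ ns → All (N ≤_) ns → blocksCoeff A as ns bs ≡ c
  blocksCoeff-eventually-constant []       tt = 0 , λ A → coeff (A ++ᵂ (0 , [] , [])) , λ { [] [] → refl }
  blocksCoeff-eventually-constant (a ∷ as) (xe , ze , bs) with blocksCoeff-eventually-constant as bs
  ... | N , tail-constant =
    length xe ⊔ N ,
    λ A → maybe′ (λ p → proj₁ (tail-constant (prefix A p))) 0ℤ (padTo (length xe) xe) , λ where
      (n ∷ ns) (len⊔N≤n ∷ len⊔N≤ns) → begin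
        blocksCoeff A (a ∷ as) (n ∷ ns) (xe , ze , bs)
          ≡⟨ constant-from (λ k → blocksCoeff A (a ∷ as) (k ∷ ns) (xe , ze , bs)) (length xe)
               (λ k → blocksCoeff-suc A a as k ns xe ze bs) n (≤-trans (m≤m⊔n _ _) len⊔N≤n) ⟩
        blocksCoeff A (a ∷ as) (length xe ∷ ns) (xe , ze , bs)
          ≡⟨ blocksCoeff-∷ A a as (length xe) ns xe ze bs ⟩
        maybe′ (λ p → blocksCoeff (prefix A p) as ns bs) 0ℤ (padTo (length xe) xe)
          ≡⟨ maybe-cong 0ℤ (λ p → proj₂ (tail-constant (prefix A p)) ns
                 (All.map (≤-trans (m≤n⊔m _ _)) len⊔N≤ns)) (padTo (length xe) xe) ⟩
        maybe′ (λ p → proj₁ (tail-constant (prefix A p))) 0ℤ (padTo (length xe) xe) ∎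
    where
    prefix : Word → Exp (length xe) → Word
    prefix A p = (A ++ᵂ zerosᵂ (length xe) p) ++ᵂ blockᵂ a ze

mainTheorem7 : (K : KeyFamily) → IsKeyFamily K →
    (β : List ℕ) (r : ℕ) (αs : Vec (List ℕ) r)
    (ye : Vec ℕ (length β)) (bs : MonoBlocks αs) →
    ∃[ N ] ∃[ c ] ((ns : Vec ℕ r) → All (N ≤_) ns → keyCoeff K β αs ns ye bs ≡ c)
mainTheorem7 K isKey β r αs ye bs =
  let open Stability K (KeyFamilyProperties.key-insertZero K isKey)
      (N , constant) = blocksCoeff-eventually-constant αs bs
  in  N , constant (length β , fromList β , ye)
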